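{- Let $(\mathcal{A},\lambda,L)$ and $(\mathcal{A}',\lambda',L)$ be $Pom_L$-bisimilar labelled asynchronous systems, $\mathcal{A}=(S,s_0,E,I,\mathrm{Tran})$, $\mathcal{A}'=(S',s'_0,E',I',\mathrm{Tran}')$. For every word $w=a_1\cdots a_k\in E^*$, $k\ge 0$, with $s_0\cdot w\in S$, there exists a word $w'=a'_1\cdots a'_k\in E'^*$ such that (i) $s'_0\cdot w'\in S'$, and (ii) the labelled asynchronous systems $(\mathcal{A}(s_0\cdot w),\lambda,L)$ and $(\mathcal{A}'(s'_0\cdot w'),\lambda',L)$ are $Pom_L$-bisimilar.
   Context: A state space $(S,E,I,\mathrm{Tran})$ consists of a set $S$ of states, a set $E$ of events with a symmetric irreflexive independence relation $I\subseteq E\times E$, and $\mathrm{Tran}\subseteq S\times E\times S$, such that: (1) $(s,a,s'),(s,a,s'')\in\mathrm{Tran}$ imply $s'=s''$; (2) if $(a,b)\in I$, $(s,a,s')\in\mathrm{Tran}$, $(s',b,s'')\in\mathrm{Tran}$, then there is $s_1$ with $(s,b,s_1),(s_1,a,s'')\in\mathrm{Tran}$. An asynchronous system $\mathcal{A}=(S,s_0,E,I,\mathrm{Tran})$ is a state space with initial state $s_0\in S$ such that every event occurs in some transition. $E^*$ is the free monoid of words over $E$. For a word $w=e_1\cdots e_k$, $s\cdot w\in S$ means there are states $s=t_0,\dots,t_k$ with $(t_{i-1},e_i,t_i)\in\mathrm{Tran}$, and then $s\cdot w=t_k$; $s\cdot(\text{empty word})=s$. A state is reachable if it equals $s_0\cdot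 w$ for some word $w$. For reachable $s$, $\mathcal{A}(s)=(S,s,E,I,\mathrm{Tran})$. A morphism $(\sigma,\eta):\mathcal{A}\to\mathcal{A}'$: a total map $\sigma:S\to S'$ with $\sigma(s_0)=s'_0$ and a partial map $\eta:E\rightharpoonup E'$ such that for each $(s_1,e,s_2)\in\mathrm{Tran}$, $(\sigma(s_1),\eta(e),\sigma(s_2))\in\mathrm{Tran}'$ if $\eta(e)$ is defined and $\sigma(s_1)=\sigma(s_2)$ otherwise, and $(\eta(e_1),\eta(e_2))\in I'$ whenever $(e_1,e_2)\in I$ and both are defined. It is open if (a) $\eta$ is total; (b) for all $s\in S$ and $(\sigma(s),e',u')\in\mathrm{Tran}'$ there is $(s,e,u)\in\mathrm{Tran}$ with $\eta(e)=e'$, $\sigma(u)=u'$; (c) for every reachable $s$, if $(s,e_1,u),(u,e_2,v)\in\mathrm{Tran}$ and $(\eta(e_1),\eta(e_2))\in I'$ then $(e_1,e_2)\in I$. A labelled asynchronous system $(\mathcal{A},\lambda,L)$ has in addition a label map $\lambda:E\to L$. A $Pom_L$-open morphism is an open morphism with $\lambda(e)=\lambda'(\eta(e))$ for all $e\in E$. Two labelled asynchronous systems are $Pom_L$-bisimilar if there is a third labelled asynchronous system (same $L$) with $Pom_L$-open morphisms to both. -}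

module Defs where

open import Data.Product using (Σ; ∃; ∃-syntax; _×_; _,_)
open import Data.List using (List; []; _∷_; length)
open import Data.Maybe using (Maybe; just; nothing)
open import Relation.Binary.PropositionalEquality using (_≡_)
open import Relation.Nullary using (¬_)
open import Level using (suc; zero)

record StateSpace : Set₁ where
  field
    S     : Set
    E     : Set
    I     : E → E → Set
    I-sym     : ∀ {a b} → I a b → I b a
    I-irrefl  : ∀ {a} → ¬ I a a
    Tran  : S → E → S → Set
    Tran-det : ∀ {s a s' s''} → Tran s a s' → Tran s a s'' → s' ≡ s''
    Tran-diamond : ∀ {a b s s' s''} → I a b → Tran s a s' → Tran s' b s'' →
                   ∃[ s₁ ] (Tran s b s₁ × Tran s₁ a s'')

record AsyncSystem : Set₁ where
  field
    space : StateSpace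
  open StateSpace space public
  field
    s₀ : S
    event-occurs : ∀ (e : E) → ∃[ s ] ∃[ s' ] Tran s e s'

record LabelledAsync (L : Set) : Set₁ where
  field
    sys : AsyncSystem
  open AsyncSystem sys public
  field
    lab : E → L

module _ (A : AsyncSystem) where
  open AsyncSystem A

  -- Run s w t  :  s · w is defined and equals t.
  data Run : S → List E → S → Set where
    run-[] : ∀ {s} → Run s [] s
    run-∷  : ∀ {s e u w t} → Tran s e u → Run u w t → Run s (e ∷ w) t

  Reachable : S → Set
  Reachable s = ∃[ w ] Run s₀ w s

_at_ : (A : AsyncSystem) → AsyncSystem.S A → AsyncSystem
A at s = record
  { space = AsyncSystem.space A
  ; s₀ = s
  ; event-occurs = AsyncSystem.event-occurs A }

_atₗ_ : ∀ {L} (A : LabelledAsync L) → LabelledAsync.S A → LabelledAsync L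
A atₗ s = record { sys = LabelledAsync.sys A at s ; lab = LabelledAsync.lab A }

record Morphism (A A' : AsyncSystem) : Set where
  private
    module A  = AsyncSystem A
    module A' = AsyncSystem A'
  field
    σ : A.S → A'.S
    η : A.E → Maybe A'.E
    σ-init : σ A.s₀ ≡ A'.s₀
    tran-def : ∀ {s₁ e s₂ e'} → A.Tran s₁ e s₂ → η e ≡ just e' →
               A'.Tran (σ s₁) e' (σ s₂)
    tran-undef : ∀ {s₁ e s₂} → A.Tran s₁ e s₂ → η e ≡ nothing → σ s₁ ≡ σ s₂
    indep : ∀ {e₁ e₂ e₁' e₂'} → A.I e₁ e₂ → η e₁ ≡ just e₁' → η e₂ ≡ just e₂' →
            A'.I e₁' e₂'

record IsOpen {A A' : AsyncSystem} (f : Morphism A A') : Set where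
  private
    module A  = AsyncSystem A
    module A' = AsyncSystem A'
  open Morphism f
  field
    η-total : ∀ (e : A.E) → ∃[ e' ] (η e ≡ just e')
    lift : ∀ (s : A.S) {e' u'} → A'.Tran (σ s) e' u' →
           ∃[ e ] ∃[ u ] (A.Tran s e u × η e ≡ just e' × σ u ≡ u')
    reflect-I : ∀ {s e₁ u e₂ v e₁' e₂'} → Reachable A s →
                A.Tran s e₁ u → A.Tran u e₂ v →
                η e₁ ≡ just e₁' → η e₂ ≡ just e₂' → A'.I e₁' e₂' → A.I e₁ e₂

record PomOpen {L : Set} (A A' : LabelledAsync L) : Set where
  private
    module A  = LabelledAsync A
    module A' = LabelledAsync A'
  field
    mor : Morphism A.sys A'.sys
    open-mor : IsOpen mor
    label-pres : ∀ (e : A.E) {e'} → Morphism.η mor e ≡ just e' → A.lab e ≡ A'.lab e'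

PomBisimilar : {L : Set} → LabelledAsync L → LabelledAsync L → Set₁
PomBisimilar {L} A A' = ∃[ B ] (PomOpen {L} B A × PomOpen B A')

-- Pull the run of w back along the Pom_L-open morphism B → A (open maps lift
-- transitions) to a run of B of the same length ending in some u, and push it
-- forward along B → A' (η is total) to a run of A' of the same length ending in
-- σ' u.  Restricting both morphisms to the initial state u gives the span
-- witnessing the bisimilarity; independence reflection survives the restriction
-- because u is reachable, so every state reachable from u is reachable in B.
module Submission where

open import Defs
open import Data.Product using (∃-syntax; _×_; _,_; proj₁; proj₂)
open import Data.List using (List; length; []; _∷_; map; _++_)
open import Data.List.Properties using (length-map)
open import Data.Nat using () renaming (suc to ℕsuc)
open import Relation.Binary.PropositionalEquality using (_≡_; refl; sym; trans; cong; subst)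

module _ (A : AsyncSystem) where
  open AsyncSystem A

  Run-++ : ∀ {s u t v w} → Run A s v u → Run A u w t → Run A s (v ++ w) t
  Run-++ run-[]        r = r
  Run-++ (run-∷ tr rv) r = run-∷ tr (Run-++ rv r)

  Run-at⁻ : ∀ x {s t w} → Run (A at x) s w t → Run A s w t
  Run-at⁻ x run-[]        = run-[]
  Run-at⁻ x (run-∷ tr rw) = run-∷ tr (Run-at⁻ x rw)

  Reachable-at⁻ : ∀ {u s} → Reachable A u → Reachable (A at u) s → Reachable A s
  Reachable-at⁻ {u} (v , rv) (w , rw) = v ++ w , Run-++ rv (Run-at⁻ u rw)

module _ {A A' : AsyncSystem} (f : Morphism A A') where
  private
    module A  = AsyncSystem A
    module A' = AsyncSystem A'
  open Morphism f

  Morphism-at : ∀ u {t} → σ u ≡ t → Morphism (A at u) (A' at t)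
  Morphism-at u σu≡t = record
    { σ = σ ; η = η ; σ-init = σu≡t
    ; tran-def = tran-def ; tran-undef = tran-undef ; indep = indep }

  IsOpen-at : IsOpen f → ∀ u {t} (σu≡t : σ u ≡ t) → Reachable A u →
              IsOpen (Morphism-at u σu≡t)
  IsOpen-at open-f u σu≡t reach-u = record
    { η-total   = η-total
    ; lift      = lift
    ; reflect-I = λ reach → reflect-I (Reachable-at⁻ A reach-u reach) }
    where open IsOpen open-f

  module _ (open-f : IsOpen f) where
    open IsOpen open-f

    η̂ : A.E → A'.E
    η̂ e = proj₁ (η-total e)

    map-Run : ∀ {s u v} → Run A s v u → Run A' (σ s) (map η̂ v) (σ u)
    map-Run run-[]                = run-[]
    map-Run (run-∷ {e = e} tr rv) = run-∷ (tran-def tr (proj₂ (η-total e))) (map-Run rv)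

    lift-Run : ∀ s {t w} → Run A' (σ s) w t →
               ∃[ v ] ∃[ u ] (length v ≡ length w × Run A s v u × σ u ≡ t)
    lift-Run s run-[] = [] , s , refl , run-[] , refl
    lift-Run s (run-∷ tr rw) with lift s tr
    ... | e , s₁ , tr₁ , _ , refl with lift-Run s₁ rw
    ... | v , u , |v|≡|w| , rv , σu≡t = e ∷ v , u , cong ℕsuc |v|≡|w| , run-∷ tr₁ rv , σu≡t

PomOpen-at : ∀ {L} {B A : LabelledAsync L} (p : PomOpen B A) u {t} →
             Morphism.σ (PomOpen.mor p) u ≡ t → Reachable (LabelledAsync.sys B) u →
             PomOpen (B atₗ u) (A atₗ t)
PomOpen-at p u σu≡t reach-u = record
  { mor        = Morphism-at mor u σu≡t
  ; open-mor   = IsOpen-at mor open-mor u σu≡t reach-u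
  ; label-pres = label-pres }
  where open PomOpen p

mainTheorem2 : {L : Set} (A A' : LabelledAsync L) → PomBisimilar A A' →
    (w : List (LabelledAsync.E A)) (t : LabelledAsync.S A) →
    Run (LabelledAsync.sys A) (LabelledAsync.s₀ A) w t →
    ∃[ w' ] ∃[ t' ] (length w' ≡ length w ×
    Run (LabelledAsync.sys A') (LabelledAsync.s₀ A') w' t' ×
    PomBisimilar (A atₗ t) (A' atₗ t'))
mainTheorem2 A A' (B , p , q) w t rw
  with lift-Run f (PomOpen.open-mor p) (LabelledAsync.s₀ B)
         (subst (λ s → Run (LabelledAsync.sys A) s w t) (sym (Morphism.σ-init f)) rw)
  where f = PomOpen.mor p
... | v , u , |v|≡|w| , rv , σu≡t =
  map η̂' v , σ' u , trans (length-map η̂' v) |v|≡|w| ,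
  subst (λ s → Run (LabelledAsync.sys A') s (map η̂' v) (σ' u)) (Morphism.σ-init g) rv' ,
  B atₗ u , PomOpen-at p u σu≡t (v , rv) , PomOpen-at q u refl (v , rv)
  where
    g   = PomOpen.mor q
    σ'  = Morphism.σ g
    η̂'  = η̂ g (PomOpen.open-mor q)
    rv' = map-Run g (PomOpen.open-mor q) rv
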